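{- Let $B$ be a unital algebra over a field of characteristic zero and $f,g\in G^I_B$. Then $f\boxplus g\in G^I_B$ and $f\boxplus_1 g\in G^I_B$.
   Context: $\mathrm{Mult}[[B]]$: sequences $f=(f_n)_{n\ge0}$, $f_n:B^n\to B$ multilinear ($f_0\in B$); $(f\cdot g)_n(x_1,\dots,x_n)=\sum_kf_k(x_1,\dots,x_k)g_{n-k}(x_{k+1},\dots,x_n)$; $I_1=\mathrm{Id}_B$, $I_n=0$ otherwise. $G^{\mathrm{inv}}_B=\{f:f_0\in B^\times\}$, $G^I_B=I\cdot G^{\mathrm{inv}}_B$. Trees: $Y_0=\{|\}$, $Y_n=\{\sigma\vee\tau:\sigma\in Y_k,\tau\in Y_l,k+l=n-1\}$ ($\sigma\vee\tau$: root with left subtree $\sigma$, right subtree $\tau$). Each $\tau\in Y_n$, $n\ge1$, is uniquely $\tau_1\vee(\tau_2\vee(\cdots\vee(\tau_k\vee|)))$; $j_i=|\tau_1|+\dots+|\tau_i|+i$. $(f\cup g)_|=1$, $(f\cup g)_\tau(x_1,\dots,x_n)=g_k((g\cup f)_{\tau_1}(x_1,\dots,x_{j_1-1})x_{j_1},\dots,(g\cup f)_{\tau_k}(x_{j_{k-1}+1},\dots,x_{j_k-1})x_{j_k})$. $R(|)=|$, $R(\sigma\vee\tau)=(|\vee R(\sigma))\vee R(\tau)$. $(f\boxplus g)_n(x_1,\dots,x_n)=\sum_{\tau\in Y_n}(f\cup g)_{R(\tau)}(x_1,1,x_2,1,\dots,1,x_n,1)$ ($n\ge1$), $(f\boxplus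 g)_0=g_0$. $(f\boxplus_1 g)_n(x_1,\dots,x_n)=\sum_{\tau\in Y_{n-1}}(g\cup f)_{|\vee R(\tau)}(x_1,1,x_2,1,\dots,1,x_n)$ ($n\ge1$), $(f\boxplus_1 g)_0=0$. -}

module Defs where

open import Level using (Level; _⊔_) renaming (suc to lsuc)
open import Algebra.Bundles using (CommutativeRing; Ring)
open import Algebra.Module.Structures using (IsModule)
open import Data.Nat using (ℕ; zero; suc) renaming (_+_ to _+ℕ_)
open import Data.Fin using (Fin)
open import Data.List as L using (List; []; _∷_)
open import Data.Vec as V using (Vec; []; _∷_; _[_]≔_)
open import Data.Vec.Relation.Binary.Pointwise.Inductive using (Pointwise)
open import Data.Product using (Σ; _×_; _,_)
open import Relation.Nullary using (¬_)

record Field (c ℓ : Level) : Set (lsuc (c ⊔ ℓ)) where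
  field
    commutativeRing : CommutativeRing c ℓ
  open CommutativeRing commutativeRing
  field
    0≉1     : ¬ (0# ≈ 1#)
    inverse : ∀ x → ¬ (x ≈ 0#) → Σ Carrier (λ y → x * y ≈ 1#)

natToRing : ∀ {c ℓ} (R : CommutativeRing c ℓ) → ℕ → CommutativeRing.Carrier R
natToRing R zero    = CommutativeRing.0# R
natToRing R (suc n) = CommutativeRing._+_ R (CommutativeRing.1# R) (natToRing R n)

CharZero : ∀ {c ℓ} → Field c ℓ → Set ℓ
CharZero F = ∀ n → ¬ (natToRing R (suc n) ≈ 0#)
  where
    R = Field.commutativeRing F
    open CommutativeRing R using (_≈_; 0#)

record UnitalAlgebra {c ℓ} (K : CommutativeRing c ℓ) (b ℓb : Level)
       : Set (c ⊔ ℓ ⊔ lsuc (b ⊔ ℓb)) where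
  field
    ring : Ring b ℓb
  open Ring ring
  private module K = CommutativeRing K
  infixr 7 _·_
  field
    _·_       : K.Carrier → Carrier → Carrier
    isModule  : IsModule K _≈_ _+_ 0# -_ _·_ (λ x k → k · x)
    ·-*-assocˡ : ∀ k x y → ((k · x) * y) ≈ (k · (x * y))
    ·-*-assocʳ : ∀ k x y → (x * (k · y)) ≈ (k · (x * y))
  open Ring ring public

-- Planar binary trees.  Y_n = trees with n internal nodes.

data Tree : Set where
  leaf : Tree
  node : Tree → Tree → Tree

size : Tree → ℕ
size leaf       = 0
size (node σ τ) = size σ +ℕ suc (size τ)

spineLen : Tree → ℕ
spineLen leaf       = 0
spineLen (node σ τ) = suc (spineLen τ)

R : Tree → Tree
R leaf       = leaf
R (node σ τ) = node (node leaf (R σ)) (R τ)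

private
  cross : List Tree → List Tree → List Tree
  cross A B = L.concatMap (λ s → L.map (node s) B) A

  -- from [Y₀,…,Yₙ] build Y_{n+1} = ⋃_k { σ ∨ τ : σ ∈ Y_k, τ ∈ Y_{n-k} }
  nextY : ∀ {n} → Vec (List Tree) n → List Tree
  nextY Ls = L.concat (V.toList (V.zipWith cross Ls (V.reverse Ls)))

Yupto : (n : ℕ) → Vec (List Tree) (suc n)
Yupto zero    = (leaf ∷ []) ∷ []
Yupto (suc n) = Yupto n V.∷ʳ nextY (Yupto n)

Y : ℕ → List Tree
Y n = V.last (Yupto n)

module Mult {c ℓ b ℓb} (K : CommutativeRing c ℓ) (A : UnitalAlgebra K b ℓb) where
  open UnitalAlgebra A
  private module K = CommutativeRing K

  B : Set b
  B = Carrier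

  -- raw sequences f = (f_n)_{n ≥ 0}, f_n : B^n → B  (f_0 is f 0 [])
  Seq : Set b
  Seq = (n : ℕ) → Vec B n → B

  record IsMultilinear {n : ℕ} (F : Vec B n → B) : Set (c ⊔ b ⊔ ℓb) where
    field
      cong     : ∀ xs ys → Pointwise _≈_ xs ys → F xs ≈ F ys
      additive : ∀ (i : Fin n) xs y z →
                 F (xs [ i ]≔ (y + z)) ≈ (F (xs [ i ]≔ y) + F (xs [ i ]≔ z))
      homog    : ∀ (i : Fin n) xs (k : K.Carrier) y →
                 F (xs [ i ]≔ (k · y)) ≈ (k · F (xs [ i ]≔ y))

  IsMult : Seq → Set (c ⊔ b ⊔ ℓb)
  IsMult f = ∀ n → IsMultilinear (f n)

  _≈ₘ_ : Seq → Seq → Set (b ⊔ ℓb)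
  f ≈ₘ g = ∀ n (xs : Vec B n) → f n xs ≈ g n xs

  sumB : List B → B
  sumB = L.foldr _+_ 0#

  splits : ∀ {n} → Vec B n → List (Σ ℕ λ k → Σ ℕ λ l → Vec B k × Vec B l)
  splits []       = (0 , 0 , [] , []) ∷ []
  splits (x ∷ xs) = (0 , _ , [] , x ∷ xs)
                  ∷ L.map (λ { (k , l , us , vs) → (suc k , l , x ∷ us , vs) }) (splits xs)

  _⊙_ : Seq → Seq → Seq
  (f ⊙ g) n xs = sumB (L.map (λ { (k , l , us , vs) → f k us * g l vs }) (splits xs))

  I : Seq
  I (suc zero) (x ∷ []) = x
  I _          _        = 0#

  Invertible : B → Set (b ⊔ ℓb)
  Invertible x = Σ B λ y → ((x * y) ≈ 1#) × ((y * x) ≈ 1#)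

  Ginv : Seq → Set (c ⊔ b ⊔ ℓb)
  Ginv h = IsMult h × Invertible (h 0 [])

  GI : Seq → Set (c ⊔ b ⊔ ℓb)
  GI f = IsMult f × Σ Seq (λ h → Ginv h × (f ≈ₘ (I ⊙ h)))

  mutual
    cup : Seq → Seq → (τ : Tree) → Vec B (size τ) → B
    cup f g leaf       _  = 1#
    cup f g (node σ τ) xs = g (spineLen (node σ τ)) (spine f g (node σ τ) xs)

    spine : Seq → Seq → (τ : Tree) → Vec B (size τ) → Vec B (spineLen τ)
    spine f g leaf       _  = []
    spine f g (node σ τ) xs with V.drop (size σ) xs
    ... | x ∷ rest = (cup g f σ (V.take (size σ) xs) * x) ∷ spine f g τ rest

  -- turn a list into a vector of the prescribed length (pads with 0 /
  -- truncates; only ever applied when the lengths agree)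
  fit : (m : ℕ) → List B → Vec B m
  fit zero    _        = []
  fit (suc m) []       = 0# ∷ fit m []
  fit (suc m) (x ∷ xs) = x ∷ fit m xs

  interleave₁ : ∀ {n} → Vec B n → List B
  interleave₁ []       = []
  interleave₁ (x ∷ xs) = x ∷ 1# ∷ interleave₁ xs

  interleave₂ : ∀ {n} → Vec B n → List B
  interleave₂ []           = []
  interleave₂ (x ∷ [])     = x ∷ []
  interleave₂ (x ∷ y ∷ xs) = x ∷ 1# ∷ interleave₂ (y ∷ xs)

  _⊞_ : Seq → Seq → Seq
  (f ⊞ g) zero    xs = g 0 []
  (f ⊞ g) (suc n) xs =
    sumB (L.map (λ τ → cup f g (R τ) (fit (size (R τ)) (interleave₁ xs))) (Y (suc n)))

  _⊞₁_ : Seq → Seq → Seq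
  (f ⊞₁ g) zero    xs = 0#
  (f ⊞₁ g) (suc n) xs =
    sumB (L.map (λ τ → cup g f (node leaf (R τ)) (fit (size (node leaf (R τ))) (interleave₂ xs))) (Y n))

{-# OPTIONS --safe #-}
-- F lies in G^I = I·G^inv exactly when F is multilinear, F₀ = 0, the first argument factors
-- out on the left, F_{n+1}(x, xs) = x F_{n+1}(1, xs), and F₁(1) is invertible. Every (f ∪ g)_τ
-- is multilinear, because each of its arguments enters exactly one slot of one f_k or g_k,
-- linearly. In a term (f ∪ g)_{R(σ∨τ)} of f ⊞ g the first argument is the first argument of an
-- f_k nested in the first argument of a g_k, and in a term (g ∪ f)_{|∨R τ} of f ⊞₁ g it is the
-- first argument of an f_k; either way it factors out. Finally (f ⊞ g)₁(1) = f₁(1) g₁(1) and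
-- (f ⊞₁ g)₁(1) = f₁(1) are invertible.
module Submission where

open import Defs
open import Level using (_⊔_)
open import Algebra.Bundles using (CommutativeRing)
open import Algebra.Module.Structures using (module IsModule)
open import Data.Nat using (ℕ; zero; suc) renaming (_+_ to _+ℕ_)
open import Data.Nat.Properties using (+-suc)
open import Data.Fin as Fin using (Fin; zero; suc; toℕ; fromℕ; inject₁; opposite; _↑ˡ_; _↑ʳ_)
open import Data.Fin.Properties using (toℕ-fromℕ; toℕ-inject₁; opposite-involutive; splitAt⁻¹-↑ˡ; splitAt⁻¹-↑ʳ)
open import Data.List as L using (List)
open import Data.List.Relation.Unary.All as All using (All; []; _∷_)
open import Data.List.Relation.Unary.All.Properties using (concat⁺; map⁺)
open import Data.Product using (_×_; _,_)
open import Function using (_∘_)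
open import Data.Sum using (inj₁; inj₂)
open import Data.Vec as V using (Vec; []; _∷_; _∷ʳ_; _++_; _[_]≔_)
open import Data.Vec.Properties using (reverse-∷; lookup-zipWith; last-∷ʳ; []≔-++-↑ˡ; []≔-++-↑ʳ)
import Data.Vec.Relation.Unary.All.Properties as VecAll
import Relation.Binary.Reasoning.Setoid as SetoidReasoning
open import Data.Vec.Relation.Binary.Pointwise.Inductive as PW using (Pointwise; []; _∷_)
open import Relation.Binary.PropositionalEquality as ≡ using (_≡_; refl)

HasSize : ℕ → Tree → Set
HasSize n τ = size τ ≡ n

resize : ∀ {m n} {Ts : List Tree} → m ≡ n → All (HasSize m) Ts → All (HasSize n) Ts
resize m≡n = All.map (λ p → ≡.trans p m≡n)

-- Copies of the private helpers behind Defs.Y; they are definitionally equal to them.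
cross : List Tree → List Tree → List Tree
cross As Bs = L.concatMap (λ s → L.map (node s) Bs) As

nextY : ∀ {n} → Vec (List Tree) n → List Tree
nextY Ls = L.concat (V.toList (V.zipWith cross Ls (V.reverse Ls)))

cross-size : ∀ {m n} {As Bs : List Tree} → All (HasSize m) As → All (HasSize n) Bs →
             All (HasSize (m +ℕ suc n)) (cross As Bs)
cross-size as bs = concat⁺ (map⁺ (All.map (λ a → map⁺ (All.map (≡.cong₂ (λ k l → k +ℕ suc l) a) bs)) as))

lookup-∷ʳ-fromℕ : ∀ {a} {A : Set a} {n} (xs : Vec A n) x → V.lookup (xs ∷ʳ x) (fromℕ n) ≡ x
lookup-∷ʳ-fromℕ []       x = refl
lookup-∷ʳ-fromℕ (_ ∷ xs) x = lookup-∷ʳ-fromℕ xs x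

lookup-∷ʳ-inject₁ : ∀ {a} {A : Set a} {n} (xs : Vec A n) x i → V.lookup (xs ∷ʳ x) (inject₁ i) ≡ V.lookup xs i
lookup-∷ʳ-inject₁ (_ ∷ xs) x zero    = refl
lookup-∷ʳ-inject₁ (_ ∷ xs) x (suc i) = lookup-∷ʳ-inject₁ xs x i

lookup-reverse : ∀ {a} {A : Set a} {n} (xs : Vec A n) i → V.lookup (V.reverse xs) i ≡ V.lookup xs (opposite i)
lookup-reverse xs i = ≡.trans (≡.cong (V.lookup (V.reverse xs)) (≡.sym (opposite-involutive i))) (reverse-opposite xs (opposite i))
  where
  reverse-opposite : ∀ {n} (xs : Vec _ n) i → V.lookup (V.reverse xs) (opposite i) ≡ V.lookup xs i
  reverse-opposite (x ∷ xs) zero    rewrite reverse-∷ x xs = lookup-∷ʳ-fromℕ (V.reverse xs) x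
  reverse-opposite (x ∷ xs) (suc i) rewrite reverse-∷ x xs =
    ≡.trans (lookup-∷ʳ-inject₁ (V.reverse xs) x (opposite i)) (reverse-opposite xs i)

toℕ+suc-opposite : ∀ {n} (i : Fin n) → toℕ i +ℕ suc (toℕ (opposite i)) ≡ n
toℕ+suc-opposite {suc n} zero    = ≡.cong suc (toℕ-fromℕ n)
toℕ+suc-opposite {suc n} (suc i) =
  ≡.cong suc (≡.trans (≡.cong (λ k → toℕ i +ℕ suc k) (toℕ-inject₁ (opposite i))) (toℕ+suc-opposite i))

GradedFrom : ∀ {m} → ℕ → Vec (List Tree) m → Set
GradedFrom o Ls = ∀ i → All (HasSize (o +ℕ toℕ i)) (V.lookup Ls i)

gradedFrom-∷ʳ : ∀ {m} o (Ls : Vec (List Tree) m) {X} →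
                GradedFrom o Ls → All (HasSize (o +ℕ m)) X → GradedFrom o (Ls ∷ʳ X)
gradedFrom-∷ʳ o []       g x zero    = x
gradedFrom-∷ʳ o (L ∷ Ls) g x zero    = g zero
gradedFrom-∷ʳ {suc m} o (L ∷ Ls) g x (suc i) =
  resize (≡.sym (+-suc o (toℕ i)))
    (gradedFrom-∷ʳ (suc o) Ls (λ j → resize (+-suc o (toℕ j)) (g (suc j))) (resize (+-suc o m) x) i)

nextY-size : ∀ {n} (Ls : Vec (List Tree) (suc n)) → GradedFrom 0 Ls → All (HasSize (suc n)) (nextY Ls)
nextY-size {n} Ls g = concat⁺ (VecAll.toList⁺ (VecAll.lookup⁻ {xs = V.zipWith cross Ls (V.reverse Ls)} crossSize))
  where
  crossSize : ∀ i → All (HasSize (suc n)) (V.lookup (V.zipWith cross Ls (V.reverse Ls)) i)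
  crossSize i rewrite lookup-zipWith cross i Ls (V.reverse Ls) | lookup-reverse Ls i =
    resize (toℕ+suc-opposite i) (cross-size (g i) (g (opposite i)))

Yupto-graded : ∀ n → GradedFrom 0 (Yupto n)
Yupto-graded zero    zero = refl ∷ []
Yupto-graded (suc n) = gradedFrom-∷ʳ 0 (Yupto n) (Yupto-graded n) (nextY-size (Yupto n) (Yupto-graded n))

Y-size : ∀ n → All (HasSize n) (Y n)
Y-size zero    = refl ∷ []
Y-size (suc n) = ≡.subst (All (HasSize (suc n))) (≡.sym (last-∷ʳ _ (Yupto n))) (nextY-size (Yupto n) (Yupto-graded n))

double : ℕ → ℕ
double zero    = zero
double (suc n) = suc (suc (double n))

double-+ : ∀ m n → double (m +ℕ n) ≡ double m +ℕ double n
double-+ zero    n = refl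
double-+ (suc m) n = ≡.cong (λ k → suc (suc k)) (double-+ m n)

size-R : ∀ τ → size (R τ) ≡ double (size τ)
size-R leaf       = refl
size-R (node σ τ) rewrite double-+ (size σ) (suc (size τ)) | size-R σ | size-R τ =
  ≡.sym (+-suc (double (size σ)) (suc (double (size τ))))

take-++ : ∀ {a} {A : Set a} {m n} (us : Vec A m) (vs : Vec A n) → V.take m (us ++ vs) ≡ us
take-++ []       vs = refl
take-++ (u ∷ us) vs = ≡.cong (u ∷_) (take-++ us vs)

drop-++ : ∀ {a} {A : Set a} {m n} (us : Vec A m) (vs : Vec A n) → V.drop m (us ++ vs) ≡ vs
drop-++ []       vs = refl
drop-++ (u ∷ us) vs = drop-++ us vs

++∷-elim : ∀ {a p} {A : Set a} {s t} (P : Vec A (s +ℕ suc t) → Set p) →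
           (∀ us y ws → P (us ++ y ∷ ws)) → ∀ xs → P xs
++∷-elim {s = s} P P-++ xs with V.splitAt s xs
... | us , y ∷ ws , refl = P-++ us y ws

twice : ∀ {n} → Fin n → Fin (double n)
twice zero    = zero
twice (suc i) = suc (suc (twice i))

twice′ : ∀ {n} → Fin (suc n) → Fin (suc (double n))
twice′ zero             = zero
twice′ {suc n} (suc i) = suc (suc (twice′ i))

module Properties {c ℓ b ℓb} (K : CommutativeRing c ℓ) (A : UnitalAlgebra K b ℓb) where
  open UnitalAlgebra A renaming (refl to ≈-refl; sym to ≈-sym; trans to ≈-trans) hiding (zero)
  open Mult K A
  open IsModule isModule using (*ₗ-congˡ; *ₗ-zeroʳ; *ₗ-distribˡ)
  open import Algebra.Properties.CommutativeSemigroup +-commutativeSemigroup using (interchange)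
  open import Algebra.Properties.Monoid *-monoid using (cancelᶜ)
  module ≈-Reasoning = SetoidReasoning setoid
  module ≋-Reasoning {n} = SetoidReasoning (PW.setoid setoid n)

  infix 4 _≋_
  _≋_ : ∀ {n} → Vec B n → Vec B n → Set (b ⊔ ℓb)
  _≋_ = Pointwise _≈_

  ≋-refl : ∀ {n} {xs : Vec B n} → xs ≋ xs
  ≋-refl = PW.refl ≈-refl

  ≋-sym : ∀ {n} {xs ys : Vec B n} → xs ≋ ys → ys ≋ xs
  ≋-sym = PW.sym ≈-sym

  ≡⇒≋ : ∀ {n} {xs ys : Vec B n} → xs ≡ ys → xs ≋ ys
  ≡⇒≋ refl = ≋-refl

  ≋-[]≔ : ∀ {n} {xs ys : Vec B n} (j : Fin n) {y z} → xs ≋ ys → y ≈ z → xs [ j ]≔ y ≋ ys [ j ]≔ z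
  ≋-[]≔ zero    (_ ∷ p) y≈z = y≈z ∷ p
  ≋-[]≔ (suc j) (e ∷ p) y≈z = e ∷ ≋-[]≔ j p y≈z

  record IsLinear (φ : B → B) : Set (c ⊔ b ⊔ ℓb) where
    field
      +-homo : ∀ y z → φ (y + z) ≈ φ y + φ z
      ·-homo : ∀ k y → φ (k · y) ≈ k · φ y

  id-linear : IsLinear (λ y → y)
  id-linear = record { +-homo = λ _ _ → ≈-refl ; ·-homo = λ _ _ → ≈-refl }

  record Routes {n k} (M : Vec B n → Vec B k) (i : Fin n) (xs : Vec B n) : Set (c ⊔ b ⊔ ℓb) where
    field
      slot   : Fin k
      φ      : B → B
      linear : IsLinear φ
      update : ∀ y → M (xs [ i ]≔ y) ≋ M xs [ slot ]≔ φ y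

  identityRoute : ∀ {n k} {M : Vec B n → Vec B k} {i xs} (j : Fin k) →
                  (∀ y → M (xs [ i ]≔ y) ≡ M xs [ j ]≔ y) → Routes M i xs
  identityRoute j eq = record { slot = j ; φ = λ y → y ; linear = id-linear ; update = λ y → ≡⇒≋ (eq y) }

  -- The maps along which multilinear maps pull back to multilinear maps: each input
  -- entry feeds a single output entry, linearly.
  record IsSeparatelyLinear {n k} (M : Vec B n → Vec B k) : Set (c ⊔ b ⊔ ℓb) where
    field
      cong   : ∀ {xs ys} → xs ≋ ys → M xs ≋ M ys
      routes : ∀ i xs → Routes M i xs

  multilinear-∘ : ∀ {n k} {G : Vec B k → B} {M : Vec B n → Vec B k} →
                  IsMultilinear G → IsSeparatelyLinear M → IsMultilinear (λ xs → G (M xs))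
  multilinear-∘ {G = G} {M} mG mM = record
    { cong     = λ xs ys p → G.cong _ _ (M.cong p)
    ; additive = additive
    ; homog    = homog
    }
    where
    module G = IsMultilinear mG
    module M = IsSeparatelyLinear mM

    additive : ∀ i xs y z → G (M (xs [ i ]≔ (y + z))) ≈ G (M (xs [ i ]≔ y)) + G (M (xs [ i ]≔ z))
    additive i xs y z = begin
      G (M (xs [ i ]≔ (y + z)))                       ≈⟨ G.cong _ _ (update (y + z)) ⟩
      G (M xs [ slot ]≔ φ (y + z))                    ≈⟨ G.cong _ _ (≋-[]≔ slot ≋-refl (+-homo y z)) ⟩
      G (M xs [ slot ]≔ (φ y + φ z))                  ≈⟨ G.additive slot (M xs) (φ y) (φ z) ⟩
      G (M xs [ slot ]≔ φ y) + G (M xs [ slot ]≔ φ z) ≈⟨ +-cong (G.cong _ _ (≋-sym (update y))) (G.cong _ _ (≋-sym (update z))) ⟩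
      G (M (xs [ i ]≔ y)) + G (M (xs [ i ]≔ z))       ∎
      where
      open Routes (M.routes i xs)
      open IsLinear linear
      open ≈-Reasoning

    homog : ∀ i xs k y → G (M (xs [ i ]≔ (k · y))) ≈ k · G (M (xs [ i ]≔ y))
    homog i xs k y = begin
      G (M (xs [ i ]≔ (k · y)))     ≈⟨ G.cong _ _ (update (k · y)) ⟩
      G (M xs [ slot ]≔ φ (k · y))  ≈⟨ G.cong _ _ (≋-[]≔ slot ≋-refl (·-homo k y)) ⟩
      G (M xs [ slot ]≔ (k · φ y))  ≈⟨ G.homog slot (M xs) k (φ y) ⟩
      k · G (M xs [ slot ]≔ φ y)    ≈⟨ *ₗ-congˡ (G.cong _ _ (≋-sym (update y))) ⟩
      k · G (M (xs [ i ]≔ y))       ∎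
      where
      open Routes (M.routes i xs)
      open IsLinear linear
      open ≈-Reasoning

  module _ {s t k} {P : Vec B s → B} {Q : Vec B t → Vec B k} {M : Vec B (s +ℕ suc t) → Vec B (suc k)}
           (mP : IsMultilinear P) (mQ : IsSeparatelyLinear Q)
           (M-++ : ∀ us x ws → M (us ++ x ∷ ws) ≡ P us * x ∷ Q ws) where
    private
      module P = IsMultilinear mP
      module Q = IsSeparatelyLinear mQ

    *∷-cong : ∀ {xs ys} → xs ≋ ys → M xs ≋ M ys
    *∷-cong {xs} {ys} p with V.splitAt s xs | V.splitAt s ys
    ... | us , x ∷ ws , refl | us′ , x′ ∷ ws′ , refl with PW.++⁻ us us′ p
    ... | pu , px ∷ pw rewrite M-++ us x ws | M-++ us′ x′ ws′ = *-cong (P.cong _ _ pu) px ∷ Q.cong pw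

    *∷-routes : ∀ i xs → Routes M i xs
    *∷-routes i xs with V.splitAt s xs | Fin.splitAt s i in split
    ... | us , x ∷ ws , refl | inj₁ j rewrite ≡.sym (splitAt⁻¹-↑ˡ split) = record
      { slot   = zero
      ; φ      = λ y → P (us [ j ]≔ y) * x
      ; linear = record
        { +-homo = λ y z → ≈-trans (*-congʳ (P.additive j us y z)) (distribʳ x _ _)
        ; ·-homo = λ k y → ≈-trans (*-congʳ (P.homog j us k y)) (·-*-assocˡ k _ x)
        }
      ; update = λ y → begin
          M ((us ++ x ∷ ws) [ j ↑ˡ suc t ]≔ y)           ≡⟨ ≡.cong M ([]≔-++-↑ˡ us (x ∷ ws) j) ⟩
          M ((us [ j ]≔ y) ++ x ∷ ws)                    ≡⟨ M-++ (us [ j ]≔ y) x ws ⟩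
          P (us [ j ]≔ y) * x ∷ Q ws                     ≡⟨ ≡.cong (_[ zero ]≔ P (us [ j ]≔ y) * x) (M-++ us x ws) ⟨
          M (us ++ x ∷ ws) [ zero ]≔ P (us [ j ]≔ y) * x ∎
      }
      where open ≋-Reasoning
    ... | us , x ∷ ws , refl | inj₂ zero rewrite ≡.sym (splitAt⁻¹-↑ʳ split) = record
      { slot   = zero
      ; φ      = λ y → P us * y
      ; linear = record { +-homo = distribˡ (P us) ; ·-homo = λ k y → ·-*-assocʳ k (P us) y }
      ; update = λ y → begin
          M ((us ++ x ∷ ws) [ s ↑ʳ zero ]≔ y) ≡⟨ ≡.cong M ([]≔-++-↑ʳ us (x ∷ ws) zero) ⟩
          M (us ++ y ∷ ws)                    ≡⟨ M-++ us y ws ⟩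
          P us * y ∷ Q ws                     ≡⟨ ≡.cong (_[ zero ]≔ P us * y) (M-++ us x ws) ⟨
          M (us ++ x ∷ ws) [ zero ]≔ P us * y ∎
      }
      where open ≋-Reasoning
    ... | us , x ∷ ws , refl | inj₂ (suc j) rewrite ≡.sym (splitAt⁻¹-↑ʳ split) = record
      { slot   = suc slot
      ; φ      = φ
      ; linear = linear
      ; update = λ y → begin
          M ((us ++ x ∷ ws) [ s ↑ʳ suc j ]≔ y) ≡⟨ ≡.cong M ([]≔-++-↑ʳ us (x ∷ ws) (suc j)) ⟩
          M (us ++ x ∷ (ws [ j ]≔ y))          ≡⟨ M-++ us x (ws [ j ]≔ y) ⟩
          P us * x ∷ Q (ws [ j ]≔ y)           ≈⟨ ≈-refl ∷ update y ⟩
          P us * x ∷ (Q ws [ slot ]≔ φ y)      ≡⟨ ≡.cong (_[ suc slot ]≔ φ y) (M-++ us x ws) ⟨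
          M (us ++ x ∷ ws) [ suc slot ]≔ φ y   ∎
      }
      where
      open Routes (Q.routes j ws)
      open ≋-Reasoning

    *∷-separatelyLinear : IsSeparatelyLinear M
    *∷-separatelyLinear = record { cong = *∷-cong ; routes = *∷-routes }

  nullary-multilinear : (F : Vec B 0 → B) → IsMultilinear F
  nullary-multilinear F = record { cong = λ { [] [] [] → ≈-refl } ; additive = λ () ; homog = λ () }

  multilinear-∷ : ∀ {n} {F : Vec B (suc n) → B} → IsMultilinear F → ∀ x → IsMultilinear (λ xs → F (x ∷ xs))
  multilinear-∷ mF x = record
    { cong     = λ xs ys p → F.cong _ _ (≈-refl ∷ p)
    ; additive = λ i → F.additive (suc i) ∘ (x ∷_)
    ; homog    = λ i → F.homog (suc i) ∘ (x ∷_)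
    }
    where module F = IsMultilinear mF

  sumB-multilinear : ∀ {a} {X : Set a} {n} (F : X → Vec B n → B) (ts : List X) →
                     All (λ t → IsMultilinear (F t)) ts → IsMultilinear (λ xs → sumB (L.map (λ t → F t xs) ts))
  sumB-multilinear F L.[] [] = record
    { cong     = λ _ _ _ → ≈-refl
    ; additive = λ _ _ _ _ → ≈-sym (+-identityʳ 0#)
    ; homog    = λ _ _ k _ → ≈-sym (*ₗ-zeroʳ k)
    }
  sumB-multilinear F (t L.∷ ts) (mFt ∷ mFts) = record
    { cong     = λ xs ys p → +-cong (Ft.cong xs ys p) (Fts.cong xs ys p)
    ; additive = λ i xs y z → ≈-trans (+-cong (Ft.additive i xs y z) (Fts.additive i xs y z)) (interchange _ _ _ _)
    ; homog    = λ i xs k y → ≈-trans (+-cong (Ft.homog i xs k y) (Fts.homog i xs k y)) (≈-sym (*ₗ-distribˡ k _ _))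
    }
    where
    module Ft  = IsMultilinear mFt
    module Fts = IsMultilinear (sumB-multilinear F ts mFts)

  spine-++ : ∀ f g σ τ (us : Vec B (size σ)) x (ws : Vec B (size τ)) →
             spine f g (node σ τ) (us ++ x ∷ ws) ≡ cup g f σ us * x ∷ spine f g τ ws
  spine-++ f g σ τ us x ws rewrite drop-++ us (x ∷ ws) | take-++ us (x ∷ ws) = refl

  mutual
    cup-multilinear : ∀ {f g} → IsMult f → IsMult g → ∀ τ → IsMultilinear (cup f g τ)
    cup-multilinear mf mg leaf       = nullary-multilinear _
    cup-multilinear mf mg (node σ τ) = multilinear-∘ (mg _) (spine-separatelyLinear mf mg (node σ τ))

    spine-separatelyLinear : ∀ {f g} → IsMult f → IsMult g → ∀ τ → IsSeparatelyLinear (spine f g τ)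
    spine-separatelyLinear mf mg leaf = record { cong = λ _ → [] ; routes = λ () }
    spine-separatelyLinear {f} {g} mf mg (node σ τ) =
      *∷-separatelyLinear (cup-multilinear mg mf σ) (spine-separatelyLinear mf mg τ) (spine-++ f g σ τ)

  interleaved₁ : ∀ n → Vec B n → Vec B (double n)
  interleaved₁ n xs = fit (double n) (interleave₁ xs)

  interleaved₂ : ∀ n → Vec B (suc n) → Vec B (suc (double n))
  interleaved₂ n xs = fit (suc (double n)) (interleave₂ xs)

  interleaved₁-separatelyLinear : ∀ n → IsSeparatelyLinear (interleaved₁ n)
  interleaved₁-separatelyLinear n = record
    { cong   = interleaved-cong
    ; routes = λ i xs → identityRoute (twice i) (interleaved-[]≔ xs i)
    }
    where
    interleaved-cong : ∀ {n} {xs ys : Vec B n} → xs ≋ ys → interleaved₁ n xs ≋ interleaved₁ n ys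
    interleaved-cong []      = []
    interleaved-cong (e ∷ p) = e ∷ ≈-refl ∷ interleaved-cong p

    interleaved-[]≔ : ∀ {n} (xs : Vec B n) i y → interleaved₁ n (xs [ i ]≔ y) ≡ interleaved₁ n xs [ twice i ]≔ y
    interleaved-[]≔ (x ∷ xs) zero    y = refl
    interleaved-[]≔ (x ∷ xs) (suc i) y = ≡.cong (λ v → x ∷ 1# ∷ v) (interleaved-[]≔ xs i y)

  interleaved₂-separatelyLinear : ∀ n → IsSeparatelyLinear (interleaved₂ n)
  interleaved₂-separatelyLinear n = record
    { cong   = interleaved-cong
    ; routes = λ i xs → identityRoute (twice′ i) (interleaved-[]≔ xs i)
    }
    where
    interleaved-cong : ∀ {n} {xs ys : Vec B (suc n)} → xs ≋ ys → interleaved₂ n xs ≋ interleaved₂ n ys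
    interleaved-cong (e ∷ [])        = e ∷ []
    interleaved-cong (e ∷ p@(_ ∷ _)) = e ∷ ≈-refl ∷ interleaved-cong p

    interleaved-[]≔ : ∀ {n} (xs : Vec B (suc n)) i y → interleaved₂ n (xs [ i ]≔ y) ≡ interleaved₂ n xs [ twice′ i ]≔ y
    interleaved-[]≔ (x ∷ [])      zero          y = refl
    interleaved-[]≔ (x ∷ x′ ∷ xs) zero          y = refl
    interleaved-[]≔ (x ∷ x′ ∷ xs) (suc zero)    y = ≡.cong (λ v → x ∷ 1# ∷ v) (interleaved-[]≔ (x′ ∷ xs) zero y)
    interleaved-[]≔ (x ∷ x′ ∷ xs) (suc (suc i)) y = ≡.cong (λ v → x ∷ 1# ∷ v) (interleaved-[]≔ (x′ ∷ xs) (suc i) y)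

  -- fit pads or truncates in general; at the exact length m = 2n it does neither.
  interleaved₁-multilinear : ∀ {m} n {G : Vec B m → B} → m ≡ double n → IsMultilinear G →
                             IsMultilinear (λ (xs : Vec B n) → G (fit m (interleave₁ xs)))
  interleaved₁-multilinear n refl mG = multilinear-∘ mG (interleaved₁-separatelyLinear n)

  interleaved₂-multilinear : ∀ {m} n {G : Vec B (suc m) → B} → m ≡ double n → IsMultilinear G →
                             IsMultilinear (λ (xs : Vec B (suc n)) → G (fit (suc m) (interleave₂ xs)))
  interleaved₂-multilinear n refl mG = multilinear-∘ mG (interleaved₂-separatelyLinear n)

  ⊞-multilinear : ∀ {f g} → IsMult f → IsMult g → IsMult (f ⊞ g)
  ⊞-multilinear mf mg zero    = nullary-multilinear _
  ⊞-multilinear mf mg (suc n) = sumB-multilinear _ (Y (suc n)) (All.map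
    (λ {τ} τ∈Y → interleaved₁-multilinear (suc n) (≡.trans (size-R τ) (≡.cong double τ∈Y)) (cup-multilinear mf mg (R τ)))
    (Y-size (suc n)))

  ⊞₁-multilinear : ∀ {f g} → IsMult f → IsMult g → IsMult (f ⊞₁ g)
  ⊞₁-multilinear mf mg zero    = nullary-multilinear _
  ⊞₁-multilinear mf mg (suc n) = sumB-multilinear _ (Y n) (All.map
    (λ {τ} τ∈Y → interleaved₂-multilinear n (≡.trans (size-R τ) (≡.cong double τ∈Y)) (cup-multilinear mg mf (node leaf (R τ))))
    (Y-size n))

  IsLeftMultiplication : (B → B) → Set (b ⊔ ℓb)
  IsLeftMultiplication φ = ∀ x → φ x ≈ x * φ 1#

  isLeftMultiplication : ∀ {φ : B → B} c → (∀ x → φ x ≈ x * c) → IsLeftMultiplication φ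
  isLeftMultiplication c φ≈·c x = ≈-trans (φ≈·c x) (*-congˡ (≈-sym (≈-trans (φ≈·c 1#) (*-identityˡ c))))

  FirstArgumentFactors : Seq → Set (b ⊔ ℓb)
  FirstArgumentFactors F = ∀ n xs → IsLeftMultiplication (λ x → F (suc n) (x ∷ xs))

  -- G^I without the witness h, which is recovered as h_n(xs) = F_{n+1}(1, xs).
  record GI′ (F : Seq) : Set (c ⊔ b ⊔ ℓb) where
    field
      multilinear : IsMult F
      vanishes₀   : F 0 [] ≈ 0#
      factors     : FirstArgumentFactors F
      invertible₁ : Invertible (F 1 (1# ∷ []))

  Invertible-cong : ∀ {x y} → x ≈ y → Invertible x → Invertible y
  Invertible-cong x≈y (x⁻¹ , xx⁻¹ , x⁻¹x) = x⁻¹ , ≈-trans (*-congʳ (≈-sym x≈y)) xx⁻¹ , ≈-trans (*-congˡ (≈-sym x≈y)) x⁻¹x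

  Invertible-* : ∀ {x y} → Invertible x → Invertible y → Invertible (x * y)
  Invertible-* {x} {y} (x⁻¹ , xx⁻¹ , x⁻¹x) (y⁻¹ , yy⁻¹ , y⁻¹y) =
    y⁻¹ * x⁻¹ , ≈-trans (cancelᶜ yy⁻¹ x x⁻¹) xx⁻¹ , ≈-trans (cancelᶜ x⁻¹x y⁻¹ y) y⁻¹y

  sumB-≈0 : ∀ {xs : List B} → All (_≈ 0#) xs → sumB xs ≈ 0#
  sumB-≈0 []         = ≈-refl
  sumB-≈0 (x≈0 ∷ xs) = ≈-trans (+-cong x≈0 (sumB-≈0 xs)) (+-identityʳ 0#)

  sumB-*ˡ : ∀ {a} {X : Set a} x (F G : X → B) (ts : List X) →
            All (λ t → F t ≈ x * G t) ts → sumB (L.map F ts) ≈ x * sumB (L.map G ts)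
  sumB-*ˡ x F G L.[]       []       = ≈-sym (zeroʳ x)
  sumB-*ˡ x F G (t L.∷ ts) (e ∷ es) = ≈-trans (+-cong e (sumB-*ˡ x F G ts es)) (≈-sym (distribˡ x _ _))

  I⊙-zero : ∀ h → (I ⊙ h) 0 [] ≈ 0#
  I⊙-zero h = ≈-trans (+-identityʳ _) (zeroˡ _)

  -- Only the split (x₁)(x₂,…) survives, since I vanishes off arity 1.
  I⊙-suc : ∀ h {n} x (xs : Vec B n) → (I ⊙ h) (suc n) (x ∷ xs) ≈ x * h n xs
  I⊙-suc h x []       = ≈-trans (+-cong (zeroˡ _) (+-identityʳ _)) (+-identityˡ _)
  I⊙-suc h x (y ∷ xs) =
    ≈-trans (+-cong (zeroˡ _) (+-congˡ (sumB-≈0 (map⁺ (map⁺ (map⁺ (All.universal (λ _ → zeroˡ _) (splits xs))))))))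
            (≈-trans (+-identityˡ _) (+-identityʳ _))

  GI⇒GI′ : ∀ {F} → GI F → GI′ F
  GI⇒GI′ (mF , h , (_ , h₀-invertible) , F≈I⊙h) = record
    { multilinear = mF
    ; vanishes₀   = ≈-trans (F≈I⊙h 0 []) (I⊙-zero h)
    ; factors     = λ n xs → isLeftMultiplication (h n xs) (λ x → ≈-trans (F≈I⊙h (suc n) (x ∷ xs)) (I⊙-suc h x xs))
    ; invertible₁ = Invertible-cong
        (≈-sym (≈-trans (F≈I⊙h 1 (1# ∷ [])) (≈-trans (I⊙-suc h 1# []) (*-identityˡ _)))) h₀-invertible
    }

  GI′⇒GI : ∀ {F} → GI′ F → GI F
  GI′⇒GI {F} F′ = multilinear , h , ((λ n → multilinear-∷ (multilinear (suc n)) 1#) , invertible₁) , F≈I⊙h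
    where
    open GI′ F′
    h : Seq
    h n xs = F (suc n) (1# ∷ xs)
    F≈I⊙h : F ≈ₘ (I ⊙ h)
    F≈I⊙h zero    []       = ≈-trans vanishes₀ (≈-sym (I⊙-zero h))
    F≈I⊙h (suc n) (x ∷ xs) = ≈-trans (factors n xs x) (≈-sym (I⊙-suc h x xs))

  cup-leafNode-factors : ∀ f g → FirstArgumentFactors g → ∀ ρ xs →
                         IsLeftMultiplication (λ x → cup f g (node leaf ρ) (x ∷ xs))
  cup-leafNode-factors f g g-factors ρ xs = isLeftMultiplication (g _ (1# ∷ spine f g ρ xs))
    (λ x → ≈-trans (g-factors _ _ (1# * x)) (*-congʳ (*-identityˡ x)))

  cup-R-factors-++ : ∀ f g → FirstArgumentFactors f → FirstArgumentFactors g → ∀ σ τ us y ws →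
                     IsLeftMultiplication (λ x → cup f g (R (node σ τ)) (x ∷ us ++ y ∷ ws))
  cup-R-factors-++ f g f-factors g-factors σ τ us y ws = isLeftMultiplication ((α * y) * β) λ x → begin
    cup f g (R (node σ τ)) (x ∷ us ++ y ∷ ws)          ≡⟨ ≡.cong (g _) (spine-++ f g (node leaf (R σ)) (R τ) (x ∷ us) y ws) ⟩
    g _ (cup g f (node leaf (R σ)) (x ∷ us) * y ∷ T)   ≈⟨ g-factors _ T _ ⟩
    (cup g f (node leaf (R σ)) (x ∷ us) * y) * β       ≈⟨ *-congʳ (*-congʳ (cup-leafNode-factors g f f-factors (R σ) us x)) ⟩
    ((x * α) * y) * β                                  ≈⟨ ≈-trans (*-congʳ (*-assoc x α y)) (*-assoc x _ β) ⟩
    x * ((α * y) * β)                                  ∎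
    where
    open ≈-Reasoning
    T : Vec B (spineLen (R τ))
    T = spine f g (R τ) ws
    α β : B
    α = cup g f (node leaf (R σ)) (1# ∷ us)
    β = g (suc (spineLen (R τ))) (1# ∷ T)

  cup-R-factors : ∀ f g → FirstArgumentFactors f → FirstArgumentFactors g → ∀ σ τ xs →
                  IsLeftMultiplication (λ x → cup f g (R (node σ τ)) (x ∷ xs))
  cup-R-factors f g f-factors g-factors σ τ =
    ++∷-elim (λ v → IsLeftMultiplication (λ x → cup f g (R (node σ τ)) (x ∷ v)))
             (cup-R-factors-++ f g f-factors g-factors σ τ)

  ⊞-factors : ∀ f g → FirstArgumentFactors f → FirstArgumentFactors g → FirstArgumentFactors (f ⊞ g)
  ⊞-factors f g f-factors g-factors n xs x =
    sumB-*ˡ x (term x) (term 1#) (Y (suc n)) (All.map (λ {τ} → factor τ) (Y-size (suc n)))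
    where
    term : B → Tree → B
    term y τ = cup f g (R τ) (fit (size (R τ)) (interleave₁ (y ∷ xs)))
    factor : ∀ τ → HasSize (suc n) τ → term x τ ≈ x * term 1# τ
    factor (node σ τ) _ = cup-R-factors f g f-factors g-factors σ τ _ x

  ⊞₁-factors : ∀ f g → FirstArgumentFactors f → FirstArgumentFactors (f ⊞₁ g)
  ⊞₁-factors f g f-factors n xs x =
    sumB-*ˡ x (term xs x) (term xs 1#) (Y n) (All.universal (factor xs) (Y n))
    where
    term : ∀ {m} → Vec B m → B → Tree → B
    term ys y τ = cup g f (node leaf (R τ)) (fit (suc (size (R τ))) (interleave₂ (y ∷ ys)))
    -- interleave₂ (y ∷ ys) only computes to y ∷ ⋯ once ys is split.
    factor : ∀ {m} (ys : Vec B m) τ → term ys x τ ≈ x * term ys 1# τ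
    factor []      τ = cup-leafNode-factors g f f-factors (R τ) _ x
    factor (_ ∷ _) τ = cup-leafNode-factors g f f-factors (R τ) _ x

  ⊞-GI′ : ∀ {f g} → GI′ f → GI′ g → GI′ (f ⊞ g)
  ⊞-GI′ {f} {g} f′ g′ = record
    { multilinear = ⊞-multilinear f.multilinear g.multilinear
    ; vanishes₀   = g.vanishes₀
    ; factors     = ⊞-factors f g f.factors g.factors
    ; invertible₁ = Invertible-cong (≈-sym unit) (Invertible-* f.invertible₁ g.invertible₁)
    }
    where
    module f = GI′ f′
    module g = GI′ g′
    open ≈-Reasoning
    f₁-1*1 : f 1 (1# * 1# ∷ []) ≈ f 1 (1# ∷ [])
    f₁-1*1 = f.multilinear 1 .IsMultilinear.cong _ _ (*-identityˡ 1# ∷ [])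
    unit : (f ⊞ g) 1 (1# ∷ []) ≈ f 1 (1# ∷ []) * g 1 (1# ∷ [])
    unit = begin
      g 1 (f 1 (1# * 1# ∷ []) * 1# ∷ []) + 0#   ≈⟨ +-identityʳ _ ⟩
      g 1 (f 1 (1# * 1# ∷ []) * 1# ∷ [])        ≈⟨ g.factors 0 [] _ ⟩
      (f 1 (1# * 1# ∷ []) * 1#) * g 1 (1# ∷ []) ≈⟨ *-congʳ (≈-trans (*-identityʳ _) f₁-1*1) ⟩
      f 1 (1# ∷ []) * g 1 (1# ∷ [])             ∎

  ⊞₁-GI′ : ∀ {f g} → GI′ f → GI′ g → GI′ (f ⊞₁ g)
  ⊞₁-GI′ {f} {g} f′ g′ = record
    { multilinear = ⊞₁-multilinear f.multilinear g.multilinear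
    ; vanishes₀   = ≈-refl
    ; factors     = ⊞₁-factors f g f.factors
    ; invertible₁ = Invertible-cong (≈-sym unit) f.invertible₁
    }
    where
    module f = GI′ f′
    module g = GI′ g′
    unit : (f ⊞₁ g) 1 (1# ∷ []) ≈ f 1 (1# ∷ [])
    unit = ≈-trans (+-identityʳ _) (f.multilinear 1 .IsMultilinear.cong _ _ (*-identityˡ 1# ∷ []))

lemma3p20 : ∀ {c ℓ b ℓb} (F : Field c ℓ) → CharZero F →
    (A : UnitalAlgebra (Field.commutativeRing F) b ℓb) →
    let open Mult (Field.commutativeRing F) A in
    (f g : Seq) → GI f → GI g → GI (f ⊞ g) × GI (f ⊞₁ g)
lemma3p20 F _ A f g f∈GI g∈GI = GI′⇒GI (⊞-GI′ f′ g′) , GI′⇒GI (⊞₁-GI′ f′ g′)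
  where
  open Properties (Field.commutativeRing F) A
  f′ : GI′ f
  f′ = GI⇒GI′ f∈GI
  g′ : GI′ g
  g′ = GI⇒GI′ g∈GI
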